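{- Let $G$ be a graph with $\mathrm{diam}(G)=2$. Then every independent set of $G$ is an outer mutual-visibility set. In addition, if $G$ is edge-critical, then the outer mutual-visibility sets of $G$ are exactly the independent sets of $G$, and $\mu_o(G)=\alpha(G)$.
   Context: All graphs are finite and simple. For $X\subseteq V(G)$, two vertices $u,v$ are $X$-visible if there is a shortest $u,v$-path $P$ with $V(P)\cap X\subseteq\{u,v\}$. $X$ is an outer mutual-visibility set if any two vertices of $X$ are $X$-visible and any $x\in X$, $y\in V(G)\setminus X$ are $X$-visible; $\mu_o(G)$ is the maximum cardinality of an outer mutual-visibility set, and $\alpha(G)$ is the independence number. An edge $xy$ is critical if there exist vertices $u,v$ with $\{u,v\}\neq\{x,y\}$ and $d_{G-xy}(u,v)>d_G(u,v)$; $G$ is edge-critical if all its edges are critical. -}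

module Defs where

open import Data.Nat using (ℕ; zero; suc; _≤_; _<_)
open import Data.Fin using (Fin)
open import Data.Fin.Subset using (Subset; _∈_; _∉_; ∣_∣)
open import Data.List using (List; []; _∷_)
open import Data.List.Relation.Unary.All using (All)
open import Data.Product using (Σ; ∃; ∃-syntax; _×_; _,_)
open import Data.Sum using (_⊎_)
open import Relation.Nullary using (¬_)
open import Relation.Binary.PropositionalEquality using (_≡_)

record Graph (n : ℕ) : Set₁ where
  field
    Adj    : Fin n → Fin n → Set
    sym    : ∀ {u v} → Adj u v → Adj v u
    irrefl : ∀ {u} → ¬ Adj u u
open Graph public

module _ {n : ℕ} where

  data Walk (A : Fin n → Fin n → Set) : Fin n → Fin n → Set where
    [_]   : (u : Fin n) → Walk A u u
    _∷⟨_⟩_ : ∀ {w v} (u : Fin n) → A u w → Walk A w v → Walk A u v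

  len : ∀ {A u v} → Walk A u v → ℕ
  len [ u ]         = 0
  len (u ∷⟨ _ ⟩ p) = suc (len p)

  vertices : ∀ {A u v} → Walk A u v → List (Fin n)
  vertices [ u ]         = u ∷ []
  vertices (u ∷⟨ _ ⟩ p) = u ∷ vertices p

  -- A walk is shortest if no u,v-walk is shorter (a shortest walk is a shortest path).
  IsShortest : ∀ {A u v} → Walk A u v → Set
  IsShortest {A} {u} {v} p = (q : Walk A u v) → len p ≤ len q

  DistA : (Fin n → Fin n → Set) → Fin n → Fin n → ℕ → Set
  DistA A u v k = Σ (Walk A u v) (λ p → IsShortest p × len p ≡ k)

  Dist : Graph n → Fin n → Fin n → ℕ → Set
  Dist G = DistA (Adj G)

  Diam : Graph n → ℕ → Set
  Diam G d = (∀ u v → ∃[ k ] (k ≤ d × Dist G u v k))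
           × (∃[ u ] ∃[ v ] Dist G u v d)

  Visible : Graph n → Subset n → Fin n → Fin n → Set
  Visible G X u v = Σ (Walk (Adj G) u v) λ p →
    IsShortest p × All (λ x → x ∈ X → x ≡ u ⊎ x ≡ v) (vertices p)

  OuterMV : Graph n → Subset n → Set
  OuterMV G X = (∀ x y → x ∈ X → y ∈ X → Visible G X x y)
              × (∀ x y → x ∈ X → y ∉ X → Visible G X x y)

  Independent : Graph n → Subset n → Set
  Independent G X = ∀ x y → x ∈ X → y ∈ X → ¬ Adj G x y

  MuO : Graph n → ℕ → Set
  MuO G k = (∃[ X ] (OuterMV G X × ∣ X ∣ ≡ k))
          × (∀ Y → OuterMV G Y → ∣ Y ∣ ≤ k)

  Alpha : Graph n → ℕ → Set
  Alpha G k = (∃[ X ] (Independent G X × ∣ X ∣ ≡ k))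
            × (∀ Y → Independent G Y → ∣ Y ∣ ≤ k)

  SamePair : Fin n → Fin n → Fin n → Fin n → Set
  SamePair a b x y = (a ≡ x × b ≡ y) ⊎ (a ≡ y × b ≡ x)

  DelEdge : Graph n → Fin n → Fin n → Fin n → Fin n → Set
  DelEdge G x y a b = Adj G a b × ¬ SamePair a b x y

  -- xy critical: ∃ u,v with {u,v} ≠ {x,y} and d_{G-xy}(u,v) > d_G(u,v)
  -- (every u,v-walk in G - xy is longer than d_G(u,v); covers d_{G-xy}(u,v) = ∞).
  Critical : Graph n → Fin n → Fin n → Set
  Critical G x y = ∃[ u ] ∃[ v ] (¬ SamePair u v x y ×
    ∃[ k ] (Dist G u v k × ((q : Walk (DelEdge G x y) u v) → k < len q)))

  EdgeCritical : Graph n → Set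
  EdgeCritical G = ∀ x y → Adj G x y → Critical G x y

{-# OPTIONS --safe #-}
module Submission where

-- In a graph of diameter at most 2 a shortest path has at most one interior
-- vertex, and that vertex is adjacent to both ends; so it misses every
-- independent set containing an end, which makes independent sets outer
-- mutual-visibility sets.
--
-- Conversely, let X be outer mutual-visibility and suppose x, y ∈ X are
-- adjacent. Criticality of xy yields u, v at distance 2 that have no common
-- neighbour in G − xy. If u (or v) lies in X, the visible shortest u,v-path
-- has its middle vertex outside X ∋ x, y; otherwise any middle vertex will
-- do. Either way some common neighbour of u and v survives the deletion of
-- xy, a contradiction. Hence μ_o and α are maxima over the same sets.

open import Defs
open import Data.Nat using (ℕ; _≤_; _<_; s≤s)
open import Data.Nat.Properties using (≤-trans; <-irrefl)
open import Data.Fin using (Fin)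
open import Data.Fin.Subset using (Subset; _∈_; _∉_; ∣_∣)
open import Data.Fin.Subset.Properties using (_∈?_)
open import Data.List.Relation.Unary.All using (All; []; _∷_)
open import Data.Product using (_×_; _,_; ∃-syntax)
open import Data.Sum using (_⊎_; inj₁; inj₂)
open import Data.Empty using (⊥; ⊥-elim)
open import Relation.Nullary using (¬_; yes; no; contradiction)
open import Relation.Binary.PropositionalEquality using (_≡_; _≢_; refl; ≢-sym)
open import Function using (_∘_)
open import Function.Bundles using (_⇔_; mk⇔; Equivalence)

module _ {n : ℕ} where

  DiamAtMost : Graph n → ℕ → Set
  DiamAtMost G d = ∀ u v → ∃[ k ] (k ≤ d × Dist G u v k)

  CommonNeighbour : (Fin n → Fin n → Set) → Fin n → Fin n → Set
  CommonNeighbour A u v = ∃[ m ] (A u m × A m v)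

  MaxCard : (Subset n → Set) → ℕ → Set
  MaxCard P k = (∃[ X ] (P X × ∣ X ∣ ≡ k)) × (∀ Y → P Y → ∣ Y ∣ ≤ k)

  maxCard-⇔ : {P Q : Subset n → Set} → (∀ X → P X ⇔ Q X) →
    ∀ k → MaxCard P k ⇔ MaxCard Q k
  maxCard-⇔ P⇔Q k = mk⇔
    (λ { ((X , pX , size) , max) →
         (X , to (P⇔Q X) pX , size) , λ Y qY → max Y (from (P⇔Q Y) qY) })
    (λ { ((X , qX , size) , max) →
         (X , from (P⇔Q X) qX , size) , λ Y pY → max Y (to (P⇔Q Y) pY) })
    where open Equivalence

module _ {n : ℕ} (G : Graph n) where

  shortest-walk≤ : ∀ {d} → DiamAtMost G d → ∀ u v →
    ∃[ p ] (IsShortest {A = Adj G} {u} {v} p × len p ≤ d)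
  shortest-walk≤ diam u v with diam u v
  ... | k , k≤d , p , shortest , refl = p , shortest , k≤d

  independent-visible : {X : Subset n} → DiamAtMost G 2 → Independent G X →
    ∀ {x} y → x ∈ X → Visible G X x y
  independent-visible {X} diam indep {x} y x∈X with shortest-walk≤ diam x y
  ... | p , shortest , p≤2 = p , shortest , avoids p p≤2
    where
    avoids : (p : Walk (Adj G) x y) → len p ≤ 2 →
      All (λ z → z ∈ X → z ≡ x ⊎ z ≡ y) (vertices p)
    avoids [ _ ] _ = (λ _ → inj₁ refl) ∷ []
    avoids (_ ∷⟨ _ ⟩ [ _ ]) _ = (λ _ → inj₁ refl) ∷ (λ _ → inj₂ refl) ∷ []
    avoids (_ ∷⟨ x~m ⟩ (m ∷⟨ _ ⟩ [ _ ])) _ =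
      (λ _ → inj₁ refl) ∷ (λ m∈X → ⊥-elim (indep x m x∈X m∈X x~m)) ∷ (λ _ → inj₂ refl) ∷ []
    avoids (_ ∷⟨ _ ⟩ (_ ∷⟨ _ ⟩ (_ ∷⟨ _ ⟩ _))) (s≤s (s≤s ()))

  independent⇒outerMV : {X : Subset n} → DiamAtMost G 2 → Independent G X → OuterMV G X
  independent⇒outerMV diam indep =
      (λ _ y x∈X _ → independent-visible diam indep y x∈X)
    , (λ _ y x∈X _ → independent-visible diam indep y x∈X)

  outerMV-visible : {X : Subset n} → OuterMV G X → ∀ {a} b → a ∈ X → Visible G X a b
  outerMV-visible {X} (inside , outside) {a} b a∈X with b ∈? X
  ... | yes b∈X = inside a b a∈X b∈X
  ... | no  b∉X = outside a b a∈X b∉X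

  visible-middle-∉ : {X : Subset n} {a b : Fin n} → a ≢ b → ¬ Adj G a b →
    CommonNeighbour (Adj G) a b → Visible G X a b →
    ∃[ m ] (m ∉ X × Adj G a m × Adj G m b)
  visible-middle-∉ a≢b _ _ ([ _ ] , _) = contradiction refl a≢b
  visible-middle-∉ _ a≁b _ ((_ ∷⟨ a~b ⟩ [ _ ]) , _) = contradiction a~b a≁b
  visible-middle-∉ {X} _ _ _ ((_ ∷⟨ a~m ⟩ (m ∷⟨ m~b ⟩ [ _ ])) , _ , (_ ∷ m-end ∷ _)) =
    m , m∉X , a~m , m~b
    where
    m∉X : m ∉ X
    m∉X m∈X with m-end m∈X
    ... | inj₁ refl = irrefl G a~m
    ... | inj₂ refl = irrefl G m~b
  visible-middle-∉ {a = a} {b} _ _ (m , a~m , m~b) ((_ ∷⟨ _ ⟩ (_ ∷⟨ _ ⟩ (_ ∷⟨ _ ⟩ _))) , shortest , _)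
    with shortest (a ∷⟨ a~m ⟩ (m ∷⟨ m~b ⟩ [ b ]))
  ... | s≤s (s≤s ())

  record CriticalPair (x y : Fin n) : Set where
    field
      {u v}         : Fin n
      u≢v           : u ≢ v
      u≁v           : ¬ Adj G u v
      common        : CommonNeighbour (Adj G) u v
      no-common-del : ¬ CommonNeighbour (DelEdge G x y) u v

  -- Distances 0 and 1 survive the deletion of xy, so the witness pair is at distance 2.
  critical-pair-at≤2 : ∀ {x y u v} → ¬ SamePair u v x y →
    (p : Walk (Adj G) u v) → IsShortest p → len p ≤ 2 →
    ((q : Walk (DelEdge G x y) u v) → len p < len q) → CriticalPair x y
  critical-pair-at≤2 _ [ u ] _ _ longer = contradiction (longer [ u ]) (<-irrefl refl)
  critical-pair-at≤2 not-xy (u ∷⟨ u~v ⟩ [ v ]) _ _ longer =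
    contradiction (longer (u ∷⟨ u~v , not-xy ⟩ [ v ])) (<-irrefl refl)
  critical-pair-at≤2 _ (u ∷⟨ u~m ⟩ (m ∷⟨ m~v ⟩ [ v ])) shortest _ longer = record
    { u≢v           = λ { refl → contradiction (shortest [ u ]) λ () }
    ; u≁v           = λ u~v → contradiction (shortest (u ∷⟨ u~v ⟩ [ v ])) λ { (s≤s ()) }
    ; common        = m , u~m , m~v
    ; no-common-del = λ (m′ , u~m′ , m′~v) →
        <-irrefl refl (longer (u ∷⟨ u~m′ ⟩ (m′ ∷⟨ m′~v ⟩ [ v ])))
    }
  critical-pair-at≤2 _ (_ ∷⟨ _ ⟩ (_ ∷⟨ _ ⟩ (_ ∷⟨ _ ⟩ _))) _ (s≤s (s≤s ())) _

  critical⇒criticalPair : DiamAtMost G 2 → ∀ {x y} → Critical G x y → CriticalPair x y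
  critical⇒criticalPair diam (u , v , not-xy , _ , (p , shortest , refl) , longer)
    with shortest-walk≤ diam u v
  ... | q , _ , q≤2 = critical-pair-at≤2 not-xy p shortest (≤-trans (shortest q) q≤2) longer

  module _ {X : Subset n} {x y : Fin n} (x∈X : x ∈ X) (y∈X : y ∈ X) where

    delEdge-∉ : ∀ {a b} → a ∉ X ⊎ b ∉ X → Adj G a b → DelEdge G x y a b
    delEdge-∉ leaves a~b = a~b , λ
      { (inj₁ (refl , refl)) → not-both leaves x∈X y∈X
      ; (inj₂ (refl , refl)) → not-both leaves y∈X x∈X }
      where
      not-both : ∀ {c d} → c ∉ X ⊎ d ∉ X → c ∈ X → d ∈ X → ⊥
      not-both (inj₁ c∉X) c∈X _ = c∉X c∈X
      not-both (inj₂ d∉X) _ d∈X = d∉X d∈X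

    outerMV-common-neighbour-del : ∀ {u v} → OuterMV G X → u ≢ v → ¬ Adj G u v →
      CommonNeighbour (Adj G) u v → CommonNeighbour (DelEdge G x y) u v
    outerMV-common-neighbour-del {u} {v} omv u≢v u≁v common
      with u ∈? X | v ∈? X
    ... | yes u∈X | _
      with visible-middle-∉ u≢v u≁v common (outerMV-visible omv v u∈X)
    ...   | m′ , m′∉X , u~m′ , m′~v =
      m′ , delEdge-∉ (inj₂ m′∉X) u~m′ , delEdge-∉ (inj₁ m′∉X) m′~v
    outerMV-common-neighbour-del {u} omv u≢v u≁v (m , u~m , m~v) | no _ | yes v∈X
      with visible-middle-∉ (≢-sym u≢v) (u≁v ∘ sym G) (m , sym G m~v , sym G u~m)
             (outerMV-visible omv u v∈X)
    ...   | m′ , m′∉X , v~m′ , m′~u =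
      m′ , delEdge-∉ (inj₂ m′∉X) (sym G m′~u) , delEdge-∉ (inj₁ m′∉X) (sym G v~m′)
    outerMV-common-neighbour-del omv _ _ (m , u~m , m~v) | no u∉X | no v∉X =
      m , delEdge-∉ (inj₁ u∉X) u~m , delEdge-∉ (inj₂ v∉X) m~v

  outerMV⇒independent : {X : Subset n} → DiamAtMost G 2 → EdgeCritical G →
    OuterMV G X → Independent G X
  outerMV⇒independent diam critical omv x y x∈X y∈X x~y =
    no-common-del (outerMV-common-neighbour-del x∈X y∈X omv u≢v u≁v common)
    where open CriticalPair (critical⇒criticalPair diam (critical x y x~y))

proposition3p2 : ∀ {n} (G : Graph n) → Diam G 2 →
    ((X : Subset n) → Independent G X → OuterMV G X)
    × (EdgeCritical G →
        ((X : Subset n) → OuterMV G X ⇔ Independent G X)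
        × ((k : ℕ) → MuO G k ⇔ Alpha G k))
proposition3p2 G (diam≤2 , _) = (λ _ → independent⇒outerMV G diam≤2) , λ critical →
  let outerMV⇔independent : (X : Subset _) → OuterMV G X ⇔ Independent G X
      outerMV⇔independent X =
        mk⇔ (outerMV⇒independent G diam≤2 critical) (independent⇒outerMV G diam≤2)
  in outerMV⇔independent , maxCard-⇔ outerMV⇔independent
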